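{- For finite posets $P$ and $Q$, one has a group isomorphism $\mathcal{BK}_{P\oplus Q}\cong\mathcal{BK}_P\times\mathcal{BK}_Q$.
   Context: For an $n$-element poset $P$, a linear extension is a list $(p_1,\dots,p_n)$ of all elements with $p_a<_P p_b$ implying $a<b$; ${\mathcal{L}}(P)$ is the set of these. The Bender--Knuth move $t_i$ ($1\le i\le n-1$) acts on ${\mathcal{L}}(P)$ by swapping $p_i,p_{i+1}$ if incomparable and fixing the list otherwise; $\mathcal{BK}_P$ is the subgroup of the symmetric group on ${\mathcal{L}}(P)$ they generate. $P\oplus Q$ is the ordinal sum: the disjoint union of $P$ and $Q$ with every element of $P$ below every element of $Q$. -}

module Defs where

open import Level using (0ℓ)
open import Data.Nat as ℕ using (ℕ; zero; suc; _+_)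
open import Data.Fin as Fin using (Fin; zero; suc; inject₁; splitAt; join)
open import Data.Fin.Properties using (join-splitAt; splitAt-join)
import Data.Fin.Properties as FinP
open import Data.Fin.Permutation.Components using (transpose)
open import Data.Sum using (_⊎_; inj₁; inj₂)
open import Data.Product using (_×_; _,_)
open import Data.Unit using (⊤; tt)
open import Data.Empty using (⊥)
open import Data.List using (List; []; _∷_; _++_; reverse; foldr)
open import Data.Bool using (Bool; if_then_else_)
open import Function using (_∘_)
open import Function.Definitions using (Bijective)
open import Relation.Nullary using (¬_; Dec; yes; no; does)
open import Relation.Nullary.Decidable using (_⊎-dec_)
open import Relation.Binary.Core using (Rel)
open import Relation.Binary.Structures using (IsDecPartialOrder; IsPartialOrder; IsPreorder)
open import Relation.Binary.PropositionalEquality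
  using (_≡_; _≢_; refl; sym; trans; cong; isEquivalence)
open import Algebra.Bundles.Raw using (RawGroup)
open import Algebra.Construct.DirectProduct using (rawGroup)

record FinPoset : Set₁ where
  field
    size  : ℕ
    _≤P_  : Rel (Fin size) 0ℓ
    isDecPartialOrder : IsDecPartialOrder _≡_ _≤P_
  open IsDecPartialOrder isDecPartialOrder public

open FinPoset public using (size; _≤P_; isDecPartialOrder; _≤?_)

_<[_]_ : {P : FinPoset} → Fin (size P) → (P' : FinPoset) → Fin (size P) → Set
_<[_]_ {P} x _ y = _≤P_ P x y × x ≢ y

-- Ordinal sum P ⊕ Q on Fin (m + n): the first m elements form P,
-- the last n elements form Q, and everything of P is below everything of Q.

module _ {m n : ℕ} (R : Rel (Fin m) 0ℓ) (S : Rel (Fin n) 0ℓ) where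
  SumRel : Fin m ⊎ Fin n → Fin m ⊎ Fin n → Set
  SumRel (inj₁ a) (inj₁ b) = R a b
  SumRel (inj₁ a) (inj₂ b) = ⊤
  SumRel (inj₂ a) (inj₁ b) = ⊥
  SumRel (inj₂ a) (inj₂ b) = S a b

  OrdSumRel : Rel (Fin (m + n)) 0ℓ
  OrdSumRel x y = SumRel (splitAt m x) (splitAt m y)

module _ (P Q : FinPoset) where
  private
    m = size P
    n = size Q
    R = _≤P_ P
    S = _≤P_ Q

  sum-refl : ∀ u → SumRel R S u u
  sum-refl (inj₁ a) = IsDecPartialOrder.refl (isDecPartialOrder P)
  sum-refl (inj₂ a) = IsDecPartialOrder.refl (isDecPartialOrder Q)

  sum-trans : ∀ u v w → SumRel R S u v → SumRel R S v w → SumRel R S u w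
  sum-trans (inj₁ a) (inj₁ b) (inj₁ c) p q = IsDecPartialOrder.trans (isDecPartialOrder P) p q
  sum-trans (inj₁ a) (inj₁ b) (inj₂ c) p q = tt
  sum-trans (inj₁ a) (inj₂ b) (inj₂ c) p q = tt
  sum-trans (inj₂ a) (inj₂ b) (inj₂ c) p q = IsDecPartialOrder.trans (isDecPartialOrder Q) p q

  sum-antisym : ∀ u v → SumRel R S u v → SumRel R S v u → u ≡ v
  sum-antisym (inj₁ a) (inj₁ b) p q = cong inj₁ (IsDecPartialOrder.antisym (isDecPartialOrder P) p q)
  sum-antisym (inj₂ a) (inj₂ b) p q = cong inj₂ (IsDecPartialOrder.antisym (isDecPartialOrder Q) p q)

  sum-dec : ∀ u v → Dec (SumRel R S u v)
  sum-dec (inj₁ a) (inj₁ b) = IsDecPartialOrder._≤?_ (isDecPartialOrder P) a b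
  sum-dec (inj₁ a) (inj₂ b) = yes tt
  sum-dec (inj₂ a) (inj₁ b) = no (λ ())
  sum-dec (inj₂ a) (inj₂ b) = IsDecPartialOrder._≤?_ (isDecPartialOrder Q) a b

  infixr 6 _⊕_
  _⊕_ : FinPoset
  _⊕_ = record
    { size = m + n
    ; _≤P_ = OrdSumRel R S
    ; isDecPartialOrder = record
      { isPartialOrder = record
        { isPreorder = record
          { isEquivalence = isEquivalence
          ; reflexive = λ { refl → sum-refl (splitAt m _) }
          ; trans = λ {x} {y} {z} → sum-trans (splitAt m x) (splitAt m y) (splitAt m z)
          }
        ; antisym = λ {x} {y} p q → trans (sym (join-splitAt m n x))
            (trans (cong (join m n) (sum-antisym (splitAt m x) (splitAt m y) p q))
                   (join-splitAt m n y))
        }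
      ; _≟_ = FinP._≟_
      ; _≤?_ = λ x y → sum-dec (splitAt m x) (splitAt m y)
      }
    }

-- A list (p_1,…,p_n) of all elements is encoded as a
-- function L : Fin n → Fin n (position ↦ element), required to be a
-- bijection; L is a linear extension iff  p_a <_P p_b  implies  a < b.

Seq : FinPoset → Set
Seq P = Fin (size P) → Fin (size P)

IsLinExt : (P : FinPoset) → Seq P → Set
IsLinExt P L =
  Bijective _≡_ _≡_ L ×
  (∀ a b → _<[_]_ {P} (L a) P (L b) → a Fin.< b)

-- For an n-element poset the moves are t_1,…,t_{n-1};
-- Gen n indexes them: g : Gen (suc k) = Fin k stands for t_{g+1}, which
-- acts on positions (0-based) g and g+1, i.e. inject₁ g and suc g.

Gen : ℕ → Set
Gen zero    = ⊥
Gen (suc k) = Fin k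

comparable? : (P : FinPoset) → (x y : Fin (size P)) →
              Dec (_≤P_ P x y ⊎ _≤P_ P y x)
comparable? P x y = _≤?_ P x y ⊎-dec _≤?_ P y x

moveN : (n : ℕ) → (Fin n → Fin n → Bool) → Gen n → (Fin n → Fin n) → (Fin n → Fin n)
moveN (suc k) comp g L =
  if comp (L (inject₁ g)) (L (suc g)) then L else (L ∘ transpose (inject₁ g) (suc g))

move : (P : FinPoset) → Gen (size P) → Seq P → Seq P
move P = moveN (size P) (λ x y → does (comparable? P x y))

-- An element of the subgroup generated by the t_i is a
-- product t_{g₁} ∘ ⋯ ∘ t_{g_r}, encoded by the word (g₁ ∷ ⋯ ∷ g_r);
-- two words are identified iff they induce the same permutation of L(P).
-- Multiplication is composition (= concatenation of words), the unit is
-- the identity (empty word), and the inverse is the reversed word (each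
-- t_i is an involution).

Word : FinPoset → Set
Word P = List (Gen (size P))

act : (P : FinPoset) → Word P → Seq P → Seq P
act P w L = foldr (move P) L w

_≈BK[_]_ : {P' : FinPoset} → Word P' → (P : FinPoset) → Word P' → Set
_≈BK[_]_ {P} w _ v = ∀ L → IsLinExt P L → ∀ a → act P w L a ≡ act P v L a

BK : FinPoset → RawGroup 0ℓ 0ℓ
BK P = record
  { Carrier = Word P
  ; _≈_ = λ w v → _≈BK[_]_ {P} w P v
  ; _∙_ = _++_
  ; ε = []
  ; _⁻¹ = reverse
  }

BK× : FinPoset → FinPoset → RawGroup 0ℓ 0ℓ
BK× P Q = rawGroup (BK P) (BK Q)

-- In a linear extension of P ⊕ Q the first |P| positions carry the elements of P and the
-- remaining ones those of Q (an element of Q at a position i < |P| would lie above all |P|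
-- elements of P, all placed before it), so the linear extensions of P ⊕ Q are exactly the
-- concatenations of one of P with one of Q.  On such a concatenation t_i (i < |P|) acts as t_i
-- on the P-part, t_{|P|+i} acts as t_i on the Q-part, and t_{|P|}, which swaps an element of P
-- with one of Q, acts trivially because these are comparable.  Hence sending a word to its
-- P-letters and its Q-letters gives a homomorphism BK_{P⊕Q} → BK_P × BK_Q.  It is well defined
-- because every finite poset has a linear extension (order by the number of strict
-- predecessors, breaking ties by index), so a linear extension of either factor can be
-- completed to one of P ⊕ Q; it is injective by the concatenation description, and surjective
-- because words of P and of Q embed.

module Submission where

open import Defs
open import Level using (Level; 0ℓ)
open import Algebra.Bundles.Raw using (RawGroup)
open import Algebra.Morphism.Structures using (module GroupMorphisms)
open import Data.Bool using (Bool; true; false; if_then_else_)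
open import Data.Empty using (⊥-elim)
open import Data.Fin as Fin
  using (Fin; zero; suc; toℕ; fromℕ; fromℕ<; inject₁; punchOut; _↑ˡ_; _↑ʳ_; splitAt; join)
import Data.Fin.Properties as Fin
open import Data.Fin.Permutation.Components using (transpose)
open import Data.Fin.Subset using (Subset; _∈_; ∣_∣)
open import Data.Fin.Subset.Properties using (p⊂q⇒∣p∣<∣q∣; ∣⊤∣≡n; ∈⊤)
open import Data.List using ([]; _∷_; _++_; [_]; reverse; map; mapMaybe)
import Data.List.Properties as List
open import Data.Maybe using (Maybe; just; nothing; maybe′)
open import Data.Nat as ℕ using (ℕ; zero; suc; _+_; z<s; s<s)
import Data.Nat.Properties as ℕ
open import Data.Product using (∃; ∃₂; _×_; _,_; proj₁; proj₂)
open import Data.Product.Relation.Binary.Lex.Strict using (×-Lex; ×-transitive; ×-compare)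
open import Data.Sum as Sum using (_⊎_; inj₁; inj₂; [_,_]′)
import Data.Sum.Properties as Sum
open import Data.Unit using (tt)
open import Data.Vec using (tabulate)
open import Data.Vec.Properties using (lookup∘tabulate; lookup⇒[]=; []=⇒lookup)
open import Function using (_∘_; _on_; id; const)
open import Function.Consequences.Propositional using (strictlySurjective⇒surjective)
open import Function.Definitions using (Injective; StrictlySurjective; Bijective)
open import Relation.Binary.Consequences using (tri⇒dec<; tri⇒irr)
open import Relation.Binary.Core using (Rel)
open import Relation.Binary.Definitions using (Transitive; Trichotomous; tri<; tri≈; tri>)
open import Relation.Binary.PropositionalEquality
  using (_≡_; _≢_; _≗_; refl; sym; trans; cong; cong₂; subst; subst₂; isEquivalence; resp₂;
         module ≡-Reasoning)
open import Relation.Nullary using (¬_; Dec; yes; no; does; contradiction)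
open import Relation.Nullary.Decidable using (dec-true; dec-false; _×-dec_; _⊎-dec_; ¬?)
open import Relation.Unary using (Pred; Decidable)

private
  variable
    ℓ : Level
    N : ℕ

injective⇒strictlySurjective : {f : Fin N → Fin N} → Injective _≡_ _≡_ f → StrictlySurjective _≡_ f
injective⇒strictlySurjective {f = f} f-inj y with Fin.any? (λ x → f x Fin.≟ y)
... | yes hit = hit
injective⇒strictlySurjective {suc N} {f = f} f-inj y | no miss =
  contradiction (Fin.injective⇒≤ punchOut∘f-injective) ℕ.1+n≰n
  where
  y≢f : ∀ x → y ≢ f x
  y≢f x y≡fx = miss (x , sym y≡fx)
  punchOut∘f-injective : Injective _≡_ _≡_ (λ x → punchOut (y≢f x))
  punchOut∘f-injective = f-inj ∘ Fin.punchOut-injective (y≢f _) (y≢f _)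

injective⇒bijective : {f : Fin N → Fin N} → Injective _≡_ _≡_ f → Bijective _≡_ _≡_ f
injective⇒bijective f-inj =
  f-inj , strictlySurjective⇒surjective (injective⇒strictlySurjective f-inj)

⟦_⟧ : {Pr : Pred (Fin N) ℓ} → Decidable Pr → Subset N
⟦ Pr? ⟧ = tabulate (does ∘ Pr?)

module _ {Pr : Pred (Fin N) ℓ} (Pr? : Decidable Pr) where

  ∈⟦⟧⁺ : ∀ {x} → Pr x → x ∈ ⟦ Pr? ⟧
  ∈⟦⟧⁺ {x} px = lookup⇒[]= x _ (trans (lookup∘tabulate _ x) (dec-true (Pr? x) px))

  ∈⟦⟧⁻ : ∀ {x} → x ∈ ⟦ Pr? ⟧ → Pr x
  ∈⟦⟧⁻ {x} x∈ with Pr? x | trans (sym (lookup∘tabulate (does ∘ Pr?) x)) ([]=⇒lookup x∈)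
  ... | yes px | _  = px
  ... | no _   | ()

∣⟦⟧∣<N : {Pr : Pred (Fin N) ℓ} (Pr? : Decidable Pr) → ∀ {w} → ¬ Pr w → ∣ ⟦ Pr? ⟧ ∣ ℕ.< N
∣⟦⟧∣<N Pr? ¬pw = subst (∣ ⟦ Pr? ⟧ ∣ ℕ.<_) (∣⊤∣≡n _)
  (p⊂q⇒∣p∣<∣q∣ ((λ _ → ∈⊤) , _ , ∈⊤ , ¬pw ∘ ∈⟦⟧⁻ Pr?))

∣⟦⟧∣-<-mono : {Pr Qr : Pred (Fin N) ℓ} (Pr? : Decidable Pr) (Qr? : Decidable Qr) →
             (∀ {x} → Pr x → Qr x) → ∀ {w} → Qr w → ¬ Pr w → ∣ ⟦ Pr? ⟧ ∣ ℕ.< ∣ ⟦ Qr? ⟧ ∣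
∣⟦⟧∣-<-mono Pr? Qr? Pr⊆Qr qw ¬pw =
  p⊂q⇒∣p∣<∣q∣ (∈⟦⟧⁺ Qr? ∘ Pr⊆Qr ∘ ∈⟦⟧⁻ Pr? , _ , ∈⟦⟧⁺ Qr? qw , ¬pw ∘ ∈⟦⟧⁻ Pr?)

module _ {_≺_ : Rel (Fin N) ℓ} (≺-trans : Transitive _≺_) (≺-compare : Trichotomous _≡_ _≺_) where

  private
    _≺?_ : ∀ x y → Dec (x ≺ y)
    _≺?_ = tri⇒dec< ≺-compare

    ≺-irrefl : ∀ {x} → ¬ x ≺ x
    ≺-irrefl = tri⇒irr ≺-compare refl

  rank : Fin N → Fin N
  rank x = fromℕ< (∣⟦⟧∣<N (_≺? x) ≺-irrefl)

  rank-mono : ∀ {x y} → x ≺ y → rank x Fin.< rank y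
  rank-mono {x} {y} x≺y = subst₂ ℕ._<_ (sym (Fin.toℕ-fromℕ< _)) (sym (Fin.toℕ-fromℕ< _))
    (∣⟦⟧∣-<-mono (_≺? x) (_≺? y) (λ z≺x → ≺-trans z≺x x≺y) x≺y ≺-irrefl)

  rank-injective : Injective _≡_ _≡_ rank
  rank-injective {x} {y} rx≡ry with ≺-compare x y
  ... | tri< x≺y _ _ = contradiction rx≡ry (Fin.<⇒≢ (rank-mono x≺y))
  ... | tri≈ _ x≡y _ = x≡y
  ... | tri> _ _ y≺x = contradiction (sym rx≡ry) (Fin.<⇒≢ (rank-mono y≺x))

module _ (P : FinPoset) where

  private
    _⊏_ : Rel (Fin (size P)) 0ℓ
    x ⊏ y = _<[_]_ {P} x P y

  linExt-fromRank : (r : Fin (size P) → Fin (size P)) → Injective _≡_ _≡_ r →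
                    (∀ {x y} → x ⊏ y → r x Fin.< r y) → ∃ (IsLinExt P)
  linExt-fromRank r r-inj r-mono = L , injective⇒bijective L-inj , L-order
    where
    L : Seq P
    L a = proj₁ (injective⇒strictlySurjective r-inj a)

    r∘L : ∀ a → r (L a) ≡ a
    r∘L a = proj₂ (injective⇒strictlySurjective r-inj a)

    L-inj : Injective _≡_ _≡_ L
    L-inj {a} {b} La≡Lb = trans (sym (r∘L a)) (trans (cong r La≡Lb) (r∘L b))

    L-order : ∀ a b → L a ⊏ L b → a Fin.< b
    L-order a b La⊏Lb = subst₂ Fin._<_ (r∘L a) (r∘L b) (r-mono La⊏Lb)

  private
    ⊏-trans : Transitive _⊏_
    ⊏-trans (x≤y , x≢y) (y≤z , _) =
      FinPoset.trans P x≤y y≤z , λ { refl → x≢y (FinPoset.antisym P x≤y y≤z) }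

    _⊏?_ : ∀ x y → Dec (x ⊏ y)
    x ⊏? y = _≤?_ P x y ×-dec ¬? (x Fin.≟ y)

    depth : Fin (size P) → ℕ
    depth x = ∣ ⟦ _⊏? x ⟧ ∣

    depth-mono : ∀ {x y} → x ⊏ y → depth x ℕ.< depth y
    depth-mono {x} {y} x⊏y =
      ∣⟦⟧∣-<-mono (_⊏? x) (_⊏? y) (λ z⊏x → ⊏-trans z⊏x x⊏y) x⊏y (λ (_ , x≢x) → x≢x refl)

    key : Fin (size P) → ℕ × Fin (size P)
    key x = depth x , x

    _≺_ : Rel (Fin (size P)) 0ℓ
    _≺_ = ×-Lex _≡_ ℕ._<_ Fin._<_ on key

    ≺-trans : Transitive _≺_
    ≺-trans = ×-transitive {_≈₁_ = _≡_} {_<₁_ = ℕ._<_} {_<₂_ = Fin._<_}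
                isEquivalence (resp₂ ℕ._<_) ℕ.<-trans Fin.<-trans

    ≺-compare : Trichotomous _≡_ _≺_
    ≺-compare x y with ×-compare sym ℕ.<-cmp Fin.<-cmp (key x) (key y)
    ... | tri< x≺y x≉y x⊁y = tri< x≺y (λ { refl → x≉y (refl , refl) }) x⊁y
    ... | tri≈ x⊀y x≈y x⊁y = tri≈ x⊀y (proj₂ x≈y) x⊁y
    ... | tri> x⊀y x≉y y≺x = tri> x⊀y (λ { refl → x≉y (refl , refl) }) y≺x

  linearExtension : ∃ (IsLinExt P)
  linearExtension = linExt-fromRank (rank ≺-trans ≺-compare) (rank-injective ≺-trans ≺-compare)
    (rank-mono ≺-trans ≺-compare ∘ inj₁ ∘ depth-mono)

below⇒≤position : (R : FinPoset) {L : Seq R} → IsLinExt R L →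
                  ∀ {k} (e : Fin k → Fin (size R)) → Injective _≡_ _≡_ e →
                  ∀ p → (∀ x → _<[_]_ {R} (e x) R (L p)) → k ℕ.≤ toℕ p
below⇒≤position R {L} ((_ , L-surj) , L-order) {k} e e-inj p e<Lp = Fin.injective⇒≤ f-inj
  where
  position : Fin (size R) → Fin (size R)
  position y = proj₁ (L-surj y)

  L∘position : ∀ y → L (position y) ≡ y
  L∘position y = proj₂ (L-surj y) refl

  before-p : ∀ x → position (e x) Fin.< p
  before-p x = L-order _ p (subst (λ y → _<[_]_ {R} y R (L p)) (sym (L∘position (e x))) (e<Lp x))

  f : Fin k → Fin (toℕ p)
  f x = fromℕ< (before-p x)

  f-inj : Injective _≡_ _≡_ f
  f-inj {x} {y} fx≡fy = e-inj (begin
    e x                  ≡⟨ L∘position (e x) ⟨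
    L (position (e x))
      ≡⟨ cong L (Fin.toℕ-injective (Fin.fromℕ<-injective _ _ (before-p x) (before-p y) fx≡fy)) ⟩
    L (position (e y))   ≡⟨ L∘position (e y) ⟩
    e y                  ∎)
    where open ≡-Reasoning

data Split (m n : ℕ) : Fin (m + n) → Set where
  inˡ : (i : Fin m) → Split m n (i ↑ˡ n)
  inʳ : (j : Fin n) → Split m n (m ↑ʳ j)

split : ∀ m n (p : Fin (m + n)) → Split m n p
split m n p with splitAt m p in eq
... | inj₁ i = subst (Split m n) (Fin.splitAt⁻¹-↑ˡ eq) (inˡ i)
... | inj₂ j = subst (Split m n) (Fin.splitAt⁻¹-↑ʳ eq) (inʳ j)

↑ˡ≢↑ʳ : ∀ {m n} (i : Fin m) (j : Fin n) → i ↑ˡ n ≢ m ↑ʳ j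
↑ˡ≢↑ʳ {m} {n} i j eq
  with trans (sym (Fin.splitAt-↑ˡ m i n)) (trans (cong (splitAt m) eq) (Fin.splitAt-↑ʳ m n j))
... | ()

↑ˡ-<⁺ : ∀ {m n} {i j : Fin m} → i Fin.< j → i ↑ˡ n Fin.< j ↑ˡ n
↑ˡ-<⁺ {i = zero}  {suc j} _         = z<s
↑ˡ-<⁺ {i = suc i} {suc j} (s<s i<j) = s<s (↑ˡ-<⁺ i<j)

↑ˡ-<⁻ : ∀ {m n} {i j : Fin m} → i ↑ˡ n Fin.< j ↑ˡ n → i Fin.< j
↑ˡ-<⁻ {i = zero}  {suc j} _         = z<s
↑ˡ-<⁻ {i = suc i} {suc j} (s<s i<j) = s<s (↑ˡ-<⁻ i<j)

↑ʳ-<⁺ : ∀ m {n} {i j : Fin n} → i Fin.< j → m ↑ʳ i Fin.< m ↑ʳ j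
↑ʳ-<⁺ zero    i<j = i<j
↑ʳ-<⁺ (suc m) i<j = s<s (↑ʳ-<⁺ m i<j)

↑ʳ-<⁻ : ∀ m {n} {i j : Fin n} → m ↑ʳ i Fin.< m ↑ʳ j → i Fin.< j
↑ʳ-<⁻ zero    i<j       = i<j
↑ʳ-<⁻ (suc m) (s<s i<j) = ↑ʳ-<⁻ m i<j

↑ˡ<↑ʳ : ∀ {m n} (i : Fin m) (j : Fin n) → i ↑ˡ n Fin.< m ↑ʳ j
↑ˡ<↑ʳ zero    j = z<s
↑ˡ<↑ʳ (suc i) j = s<s (↑ˡ<↑ʳ i j)

transpose-fixes : ∀ {a b x : Fin N} → x ≢ a → x ≢ b → transpose a b x ≡ x
transpose-fixes {a = a} {b} {x} x≢a x≢b
  rewrite dec-false (x Fin.≟ a) x≢a | dec-false (x Fin.≟ b) x≢b = refl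

transpose-natural : ∀ {k l} {f : Fin k → Fin l} → Injective _≡_ _≡_ f → ∀ a b x →
                    transpose (f a) (f b) (f x) ≡ f (transpose a b x)
transpose-natural {f = f} f-inj a b x with x Fin.≟ a
... | yes refl rewrite dec-true (f x Fin.≟ f x) refl = refl
... | no x≢a with x Fin.≟ b
...   | yes refl rewrite dec-false (f x Fin.≟ f a) (x≢a ∘ f-inj) | dec-true (f x Fin.≟ f x) refl = refl
...   | no x≢b = transpose-fixes (x≢a ∘ f-inj) (x≢b ∘ f-inj)

infixr 5 _++ˢ_
_++ˢ_ : ∀ {m n} → (Fin m → Fin m) → (Fin n → Fin n) → Fin (m + n) → Fin (m + n)
_++ˢ_ {m} {n} A B = join m n ∘ Sum.map A B ∘ splitAt m

++ˢ-↑ˡ : ∀ {m n} (A : Fin m → Fin m) (B : Fin n → Fin n) i → (A ++ˢ B) (i ↑ˡ n) ≡ A i ↑ˡ n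
++ˢ-↑ˡ {m} {n} A B i = cong (join m n ∘ Sum.map A B) (Fin.splitAt-↑ˡ m i n)

++ˢ-↑ʳ : ∀ {m n} (A : Fin m → Fin m) (B : Fin n → Fin n) j → (A ++ˢ B) (m ↑ʳ j) ≡ m ↑ʳ B j
++ˢ-↑ʳ {m} {n} A B j = cong (join m n ∘ Sum.map A B) (Fin.splitAt-↑ʳ m n j)

++ˢ-cong : ∀ {m n} {A A′ : Fin m → Fin m} {B B′ : Fin n → Fin n} → A ≗ A′ → B ≗ B′ → A ++ˢ B ≗ A′ ++ˢ B′
++ˢ-cong {m} {n} A≗A′ B≗B′ = cong (join m n) ∘ Sum.map-cong A≗A′ B≗B′ ∘ splitAt m

++ˢ-injective : ∀ {m n} {A : Fin m → Fin m} {B : Fin n → Fin n} →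
                Injective _≡_ _≡_ A → Injective _≡_ _≡_ B → Injective _≡_ _≡_ (A ++ˢ B)
++ˢ-injective {m} {n} {A} {B} A-inj B-inj {p} {q} eq with split m n p | split m n q
... | inˡ i | inˡ j = cong (_↑ˡ n) (A-inj (Fin.↑ˡ-injective n _ _
                        (trans (sym (++ˢ-↑ˡ A B i)) (trans eq (++ˢ-↑ˡ A B j)))))
... | inʳ i | inʳ j = cong (m ↑ʳ_) (B-inj (Fin.↑ʳ-injective m _ _
                        (trans (sym (++ˢ-↑ʳ A B i)) (trans eq (++ˢ-↑ʳ A B j)))))
... | inˡ i | inʳ j = ⊥-elim (↑ˡ≢↑ʳ _ _ (trans (sym (++ˢ-↑ˡ A B i)) (trans eq (++ˢ-↑ʳ A B j))))
... | inʳ i | inˡ j = ⊥-elim (↑ˡ≢↑ʳ _ _ (trans (sym (++ˢ-↑ˡ A B j)) (trans (sym eq) (++ˢ-↑ʳ A B i))))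

module _ {m n} (A : Fin m → Fin m) (B : Fin n → Fin n) where

  ++ˢ-∘-transpose-↑ˡ : ∀ a b → (A ++ˢ B) ∘ transpose (a ↑ˡ n) (b ↑ˡ n) ≗ (A ∘ transpose a b) ++ˢ B
  ++ˢ-∘-transpose-↑ˡ a b p with split m n p
  ... | inˡ i = begin
    (A ++ˢ B) (transpose (a ↑ˡ n) (b ↑ˡ n) (i ↑ˡ n))
      ≡⟨ cong (A ++ˢ B) (transpose-natural (Fin.↑ˡ-injective n _ _) a b i) ⟩
    (A ++ˢ B) (transpose a b i ↑ˡ n)
      ≡⟨ ++ˢ-↑ˡ A B _ ⟩
    A (transpose a b i) ↑ˡ n
      ≡⟨ ++ˢ-↑ˡ (A ∘ transpose a b) B i ⟨
    ((A ∘ transpose a b) ++ˢ B) (i ↑ˡ n) ∎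
    where open ≡-Reasoning
  ... | inʳ j = begin
    (A ++ˢ B) (transpose (a ↑ˡ n) (b ↑ˡ n) (m ↑ʳ j))
      ≡⟨ cong (A ++ˢ B) (transpose-fixes (↑ˡ≢↑ʳ a j ∘ sym) (↑ˡ≢↑ʳ b j ∘ sym)) ⟩
    (A ++ˢ B) (m ↑ʳ j)
      ≡⟨ ++ˢ-↑ʳ A B j ⟩
    m ↑ʳ B j
      ≡⟨ ++ˢ-↑ʳ (A ∘ transpose a b) B j ⟨
    ((A ∘ transpose a b) ++ˢ B) (m ↑ʳ j) ∎
    where open ≡-Reasoning

  ++ˢ-∘-transpose-↑ʳ : ∀ a b → (A ++ˢ B) ∘ transpose (m ↑ʳ a) (m ↑ʳ b) ≗ A ++ˢ (B ∘ transpose a b)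
  ++ˢ-∘-transpose-↑ʳ a b p with split m n p
  ... | inˡ i = begin
    (A ++ˢ B) (transpose (m ↑ʳ a) (m ↑ʳ b) (i ↑ˡ n))
      ≡⟨ cong (A ++ˢ B) (transpose-fixes (↑ˡ≢↑ʳ i a) (↑ˡ≢↑ʳ i b)) ⟩
    (A ++ˢ B) (i ↑ˡ n)
      ≡⟨ ++ˢ-↑ˡ A B i ⟩
    A i ↑ˡ n
      ≡⟨ ++ˢ-↑ˡ A (B ∘ transpose a b) i ⟨
    (A ++ˢ (B ∘ transpose a b)) (i ↑ˡ n) ∎
    where open ≡-Reasoning
  ... | inʳ j = begin
    (A ++ˢ B) (transpose (m ↑ʳ a) (m ↑ʳ b) (m ↑ʳ j))
      ≡⟨ cong (A ++ˢ B) (transpose-natural (Fin.↑ʳ-injective m _ _) a b j) ⟩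
    (A ++ˢ B) (m ↑ʳ transpose a b j)
      ≡⟨ ++ˢ-↑ʳ A B _ ⟩
    m ↑ʳ B (transpose a b j)
      ≡⟨ ++ˢ-↑ʳ A (B ∘ transpose a b) j ⟨
    (A ++ˢ (B ∘ transpose a b)) (m ↑ʳ j) ∎
    where open ≡-Reasoning

-- moveN (suc k) c g is definitionally moveAt c (inject₁ g) (suc g).
moveAt : (Fin N → Fin N → Bool) → Fin N → Fin N → (Fin N → Fin N) → Fin N → Fin N
moveAt c i j L = if c (L i) (L j) then L else L ∘ transpose i j

record IsOrdinalSumComparison {m n} (c₁ : Fin m → Fin m → Bool) (c₂ : Fin n → Fin n → Bool)
                              (c : Fin (m + n) → Fin (m + n) → Bool) : Set where
  field
    ↑ˡ↑ˡ : ∀ a b → c (a ↑ˡ n) (b ↑ˡ n) ≡ c₁ a b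
    ↑ʳ↑ʳ : ∀ a b → c (m ↑ʳ a) (m ↑ʳ b) ≡ c₂ a b
    ↑ˡ↑ʳ : ∀ a b → c (a ↑ˡ n) (m ↑ʳ b) ≡ true

module _ {m n c₁ c₂ c} (isSum : IsOrdinalSumComparison {m} {n} c₁ c₂ c)
         (A : Fin m → Fin m) (B : Fin n → Fin n) where
  open IsOrdinalSumComparison isSum

  moveAt-↑ˡ : ∀ a b → moveAt c (a ↑ˡ n) (b ↑ˡ n) (A ++ˢ B) ≗ moveAt c₁ a b A ++ˢ B
  moveAt-↑ˡ a b p rewrite ++ˢ-↑ˡ A B a | ++ˢ-↑ˡ A B b | ↑ˡ↑ˡ (A a) (A b) with c₁ (A a) (A b)
  ... | true  = refl
  ... | false = ++ˢ-∘-transpose-↑ˡ A B a b p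

  moveAt-↑ʳ : ∀ a b → moveAt c (m ↑ʳ a) (m ↑ʳ b) (A ++ˢ B) ≗ A ++ˢ moveAt c₂ a b B
  moveAt-↑ʳ a b p rewrite ++ˢ-↑ʳ A B a | ++ˢ-↑ʳ A B b | ↑ʳ↑ʳ (B a) (B b) with c₂ (B a) (B b)
  ... | true  = refl
  ... | false = ++ˢ-∘-transpose-↑ʳ A B a b p

  moveAt-↑ˡ↑ʳ : ∀ a b → moveAt c (a ↑ˡ n) (m ↑ʳ b) (A ++ˢ B) ≗ A ++ˢ B
  moveAt-↑ˡ↑ʳ a b p rewrite ++ˢ-↑ˡ A B a | ++ˢ-↑ʳ A B b | ↑ˡ↑ʳ (A a) (B b) = refl

_↑ᵍˡ_ : ∀ {m} → Gen m → ∀ n → Gen (m + n)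
_↑ᵍˡ_ {suc m} h n = h ↑ˡ n

_↑ᵍʳ_ : ∀ m {n} → Gen n → Gen (m + n)
_↑ᵍʳ_ zero          h = h
_↑ᵍʳ_ (suc m) {suc n} h = m ↑ʳ suc h

-- In the paper's 1-based numbering the moves of P ⊕ Q are t_i (i < |P|), which is t_i of P,
-- t_{|P|+i}, which is t_i of Q, and t_{|P|}, which swaps the last position of P with the first of Q.
data GenView : (m n : ℕ) → Gen (m + n) → Set where
  inˡ   : ∀ {m} n (h : Gen m) → GenView m n (h ↑ᵍˡ n)
  inʳ   : ∀ m {n} (h : Gen n) → GenView m n (m ↑ᵍʳ h)
  cross : ∀ m n → GenView (suc m) (suc n) (m ↑ʳ zero)

genView : ∀ m n (g : Gen (m + n)) → GenView m n g
genView zero n g = inʳ zero g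
genView (suc m) n g with splitAt m g in eq
... | inj₁ h = subst (GenView (suc m) n) (Fin.splitAt⁻¹-↑ˡ eq) (inˡ n h)
genView (suc m) (suc n) g | inj₂ zero    =
  subst (GenView (suc m) (suc n)) (Fin.splitAt⁻¹-↑ʳ eq) (cross m n)
genView (suc m) (suc n) g | inj₂ (suc h) =
  subst (GenView (suc m) (suc n)) (Fin.splitAt⁻¹-↑ʳ eq) (inʳ (suc m) h)

fromUpper : ∀ {n} → Fin n → Maybe (Gen n)
fromUpper {suc n} zero    = nothing
fromUpper {suc n} (suc h) = just h

projˡ : ∀ {m n} → Gen (m + n) → Maybe (Gen m)
projˡ {zero}  g = nothing
projˡ {suc m} g = [ just , const nothing ]′ (splitAt m g)

projʳ : ∀ {m n} → Gen (m + n) → Maybe (Gen n)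
projʳ {zero}  g = just g
projʳ {suc m} g = [ const nothing , fromUpper ]′ (splitAt m g)

projˡ-↑ᵍˡ : ∀ {m n} (h : Gen m) → projˡ (h ↑ᵍˡ n) ≡ just h
projˡ-↑ᵍˡ {suc m} {n} h = cong [ just , const nothing ]′ (Fin.splitAt-↑ˡ m h n)

projʳ-↑ᵍˡ : ∀ {m n} (h : Gen m) → projʳ {m} {n} (h ↑ᵍˡ n) ≡ nothing
projʳ-↑ᵍˡ {suc m} {n} h = cong [ const nothing , fromUpper ]′ (Fin.splitAt-↑ˡ m h n)

projˡ-↑ᵍʳ : ∀ m {n} (h : Gen n) → projˡ {m} {n} (m ↑ᵍʳ h) ≡ nothing
projˡ-↑ᵍʳ zero            h = refl
projˡ-↑ᵍʳ (suc m) {suc n} h = cong [ just , const nothing ]′ (Fin.splitAt-↑ʳ m (suc n) (suc h))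

projʳ-↑ᵍʳ : ∀ m {n} (h : Gen n) → projʳ (m ↑ᵍʳ h) ≡ just h
projʳ-↑ᵍʳ zero            h = refl
projʳ-↑ᵍʳ (suc m) {suc n} h = cong [ const nothing , fromUpper ]′ (Fin.splitAt-↑ʳ m (suc n) (suc h))

projˡ-cross : ∀ m n → projˡ {suc m} {suc n} (m ↑ʳ zero) ≡ nothing
projˡ-cross m n = cong [ just , const nothing ]′ (Fin.splitAt-↑ʳ m (suc n) zero)

projʳ-cross : ∀ m n → projʳ {suc m} {suc n} (m ↑ʳ zero) ≡ nothing
projʳ-cross m n = cong [ const nothing , fromUpper ]′ (Fin.splitAt-↑ʳ m (suc n) zero)

inject₁-↑ˡ : ∀ {m} (i : Fin m) n → inject₁ (i ↑ˡ n) ≡ inject₁ i ↑ˡ n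
inject₁-↑ˡ zero    n = refl
inject₁-↑ˡ (suc i) n = cong suc (inject₁-↑ˡ i n)

inject₁-↑ʳ-suc : ∀ m {n} (i : Fin n) → inject₁ (m ↑ʳ suc i) ≡ suc m ↑ʳ inject₁ i
inject₁-↑ʳ-suc zero    i = refl
inject₁-↑ʳ-suc (suc m) i = cong suc (inject₁-↑ʳ-suc m i)

inject₁-↑ʳ-zero : ∀ m {n} → inject₁ (m ↑ʳ zero {n}) ≡ fromℕ m ↑ˡ suc n
inject₁-↑ʳ-zero zero    = refl
inject₁-↑ʳ-zero (suc m) = cong suc (inject₁-↑ʳ-zero m)

maybeMove : ∀ {k} → (Fin k → Fin k → Bool) → Maybe (Gen k) → (Fin k → Fin k) → Fin k → Fin k
maybeMove {k} c = maybe′ (moveN k c) id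

moveN-↑ᵍˡ : ∀ {m n c₁ c₂ c} → IsOrdinalSumComparison {m} {n} c₁ c₂ c →
            ∀ h A B → moveN (m + n) c (h ↑ᵍˡ n) (A ++ˢ B) ≗ moveN m c₁ h A ++ˢ B
moveN-↑ᵍˡ {suc m} {n} isSum h A B rewrite inject₁-↑ˡ h n =
  moveAt-↑ˡ isSum A B (inject₁ h) (suc h)

moveN-↑ᵍʳ : ∀ {m n c₁ c₂ c} → IsOrdinalSumComparison {m} {n} c₁ c₂ c →
            ∀ h A B → moveN (m + n) c (m ↑ᵍʳ h) (A ++ˢ B) ≗ A ++ˢ moveN n c₂ h B
moveN-↑ᵍʳ {zero}  {suc n} isSum h A B = moveAt-↑ʳ isSum A B (inject₁ h) (suc h)
moveN-↑ᵍʳ {suc m} {suc n} isSum h A B rewrite inject₁-↑ʳ-suc m h =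
  moveAt-↑ʳ isSum A B (inject₁ h) (suc h)

moveN-cross : ∀ {m n c₁ c₂ c} → IsOrdinalSumComparison {suc m} {suc n} c₁ c₂ c →
              ∀ A B → moveN (suc m + suc n) c (m ↑ʳ zero) (A ++ˢ B) ≗ A ++ˢ B
moveN-cross {m} {n} isSum A B rewrite inject₁-↑ʳ-zero m {n} =
  moveAt-↑ˡ↑ʳ isSum A B (fromℕ m) zero

moveN-++ˢ : ∀ {m n c₁ c₂ c} → IsOrdinalSumComparison {m} {n} c₁ c₂ c → ∀ g A B →
            moveN (m + n) c g (A ++ˢ B) ≗ maybeMove c₁ (projˡ g) A ++ˢ maybeMove c₂ (projʳ g) B
moveN-++ˢ {m} {n} isSum g A B with genView m n g
... | inˡ _ h   rewrite projʳ-↑ᵍˡ {n = n} h | projˡ-↑ᵍˡ {n = n} h = moveN-↑ᵍˡ isSum h A B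
... | inʳ _ h   rewrite projˡ-↑ᵍʳ m h | projʳ-↑ᵍʳ m h = moveN-↑ᵍʳ isSum h A B
... | cross m n rewrite projˡ-cross m n | projʳ-cross m n = moveN-cross isSum A B

mapMaybe-reverse : ∀ {A B : Set} (f : A → Maybe B) xs → mapMaybe f (reverse xs) ≡ reverse (mapMaybe f xs)
mapMaybe-reverse f []       = refl
mapMaybe-reverse f (x ∷ xs) = begin
  mapMaybe f (reverse (x ∷ xs))
    ≡⟨ cong (mapMaybe f) (List.unfold-reverse x xs) ⟩
  mapMaybe f (reverse xs ++ [ x ])
    ≡⟨ List.mapMaybe-++ f (reverse xs) [ x ] ⟩
  mapMaybe f (reverse xs) ++ mapMaybe f [ x ]
    ≡⟨ cong₂ _++_ (mapMaybe-reverse f xs) (sym reverse-singleton) ⟩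
  reverse (mapMaybe f xs) ++ reverse (mapMaybe f [ x ])
    ≡⟨ List.reverse-++ (mapMaybe f [ x ]) (mapMaybe f xs) ⟨
  reverse (mapMaybe f [ x ] ++ mapMaybe f xs)
    ≡⟨ cong reverse (List.mapMaybe-++ f [ x ] xs) ⟨
  reverse (mapMaybe f (x ∷ xs)) ∎
  where
  open ≡-Reasoning
  reverse-singleton : reverse (mapMaybe f [ x ]) ≡ mapMaybe f [ x ]
  reverse-singleton with f x
  ... | just _  = refl
  ... | nothing = refl

moveN-cong : ∀ k c g {L L′ : Fin k → Fin k} → L ≗ L′ → moveN k c g L ≗ moveN k c g L′
moveN-cong (suc k) c g {L} {L′} L≗L′ p
  rewrite L≗L′ (inject₁ g) | L≗L′ (suc g) with c (L′ (inject₁ g)) (L′ (suc g))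
... | true  = L≗L′ p
... | false = L≗L′ (transpose (inject₁ g) (suc g) p)

module _ (R : FinPoset) where

  open RawGroup (BK R) using (_≈_)

  comparable : Fin (size R) → Fin (size R) → Bool
  comparable x y = does (comparable? R x y)

  act-cong : ∀ w {L L′} → L ≗ L′ → act R w L ≗ act R w L′
  act-cong []      L≗L′ = L≗L′
  act-cong (g ∷ w) L≗L′ = moveN-cong (size R) comparable g (act-cong w L≗L′)

  act-mapMaybe-∷ : ∀ {A : Set} (f : A → Maybe (Gen (size R))) g w L →
                   act R (mapMaybe f (g ∷ w)) L ≡ maybeMove comparable (f g) (act R (mapMaybe f w) L)
  act-mapMaybe-∷ f g w L with f g
  ... | just _  = refl
  ... | nothing = refl

  ≈-reflexive : ∀ {w v} → w ≡ v → w ≈ v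
  ≈-reflexive refl _ _ _ = refl

  ≈-trans : ∀ {u v w} → u ≈ v → v ≈ w → u ≈ w
  ≈-trans u≈v v≈w L L-lin a = trans (u≈v L L-lin a) (v≈w L L-lin a)

module OrdinalSum (P Q : FinPoset) where

  private
    m n : ℕ
    m = size P
    n = size Q

    infix 4 _≤₁_ _≤₂_ _≤⊕_ _<₁_ _<₂_ _<⊕_ _≈₁_ _≈₂_ _≈⊕_

    _≤₁_ : Rel (Fin m) 0ℓ
    _≤₁_ = _≤P_ P

    _≤₂_ : Rel (Fin n) 0ℓ
    _≤₂_ = _≤P_ Q

    _≤⊕_ : Rel (Fin (m + n)) 0ℓ
    _≤⊕_ = _≤P_ (P ⊕ Q)

    _<₁_ : Rel (Fin m) 0ℓ
    x <₁ y = _<[_]_ {P} x P y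

    _<₂_ : Rel (Fin n) 0ℓ
    x <₂ y = _<[_]_ {Q} x Q y

    _<⊕_ : Rel (Fin (m + n)) 0ℓ
    x <⊕ y = _<[_]_ {P ⊕ Q} x (P ⊕ Q) y

    _≈₁_ : Rel (Word P) 0ℓ
    _≈₁_ = RawGroup._≈_ (BK P)

    _≈₂_ : Rel (Word Q) 0ℓ
    _≈₂_ = RawGroup._≈_ (BK Q)

    _≈⊕_ : Rel (Word (P ⊕ Q)) 0ℓ
    _≈⊕_ = RawGroup._≈_ (BK (P ⊕ Q))

  <⊕-↑ˡ⁺ : ∀ {a b} → a <₁ b → a ↑ˡ n <⊕ b ↑ˡ n
  <⊕-↑ˡ⁺ {a} {b} (a≤b , a≢b) =
    subst₂ (SumRel _≤₁_ _≤₂_) (sym (Fin.splitAt-↑ˡ m a n)) (sym (Fin.splitAt-↑ˡ m b n)) a≤b ,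
    a≢b ∘ Fin.↑ˡ-injective n a b

  <⊕-↑ˡ⁻ : ∀ {a b} → a ↑ˡ n <⊕ b ↑ˡ n → a <₁ b
  <⊕-↑ˡ⁻ {a} {b} (a≤b , a≢b) =
    subst₂ (SumRel _≤₁_ _≤₂_) (Fin.splitAt-↑ˡ m a n) (Fin.splitAt-↑ˡ m b n) a≤b ,
    a≢b ∘ cong (_↑ˡ n)

  <⊕-↑ʳ⁺ : ∀ {a b} → a <₂ b → m ↑ʳ a <⊕ m ↑ʳ b
  <⊕-↑ʳ⁺ {a} {b} (a≤b , a≢b) =
    subst₂ (SumRel _≤₁_ _≤₂_) (sym (Fin.splitAt-↑ʳ m n a)) (sym (Fin.splitAt-↑ʳ m n b)) a≤b ,
    a≢b ∘ Fin.↑ʳ-injective m a b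

  <⊕-↑ʳ⁻ : ∀ {a b} → m ↑ʳ a <⊕ m ↑ʳ b → a <₂ b
  <⊕-↑ʳ⁻ {a} {b} (a≤b , a≢b) =
    subst₂ (SumRel _≤₁_ _≤₂_) (Fin.splitAt-↑ʳ m n a) (Fin.splitAt-↑ʳ m n b) a≤b ,
    a≢b ∘ cong (m ↑ʳ_)

  ↑ˡ<⊕↑ʳ : ∀ a b → a ↑ˡ n <⊕ m ↑ʳ b
  ↑ˡ<⊕↑ʳ a b =
    subst₂ (SumRel _≤₁_ _≤₂_) (sym (Fin.splitAt-↑ˡ m a n)) (sym (Fin.splitAt-↑ʳ m n b)) tt ,
    ↑ˡ≢↑ʳ a b

  ↑ʳ≰⊕↑ˡ : ∀ a b → ¬ m ↑ʳ b ≤⊕ a ↑ˡ n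
  ↑ʳ≰⊕↑ˡ a b = subst₂ (SumRel _≤₁_ _≤₂_) (Fin.splitAt-↑ʳ m n b) (Fin.splitAt-↑ˡ m a n)

  ++ˢ-isLinExt : ∀ {A B} → IsLinExt P A → IsLinExt Q B → IsLinExt (P ⊕ Q) (A ++ˢ B)
  ++ˢ-isLinExt {A} {B} ((A-inj , _) , A-order) ((B-inj , _) , B-order) =
    injective⇒bijective (++ˢ-injective A-inj B-inj) , order
    where
    order : ∀ p q → (A ++ˢ B) p <⊕ (A ++ˢ B) q → p Fin.< q
    order p q lt with split m n p | split m n q
    ... | inˡ i | inˡ j = ↑ˡ-<⁺ (A-order i j (<⊕-↑ˡ⁻ (subst₂ _<⊕_ (++ˢ-↑ˡ A B i) (++ˢ-↑ˡ A B j) lt)))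
    ... | inʳ i | inʳ j = ↑ʳ-<⁺ m (B-order i j (<⊕-↑ʳ⁻ (subst₂ _<⊕_ (++ˢ-↑ʳ A B i) (++ˢ-↑ʳ A B j) lt)))
    ... | inˡ i | inʳ j = ↑ˡ<↑ʳ i j
    ... | inʳ i | inˡ j = ⊥-elim (↑ʳ≰⊕↑ˡ _ _ (proj₁ (subst₂ _<⊕_ (++ˢ-↑ʳ A B i) (++ˢ-↑ˡ A B j) lt)))

  module _ {L : Seq (P ⊕ Q)} (L-lin : IsLinExt (P ⊕ Q) L) where

    private
      L-inj : Injective _≡_ _≡_ L
      L-inj = proj₁ (proj₁ L-lin)

      L-order : ∀ a b → L a <⊕ L b → a Fin.< b
      L-order = proj₂ L-lin

      leftBlock : ∀ i → ∃ λ a → L (i ↑ˡ n) ≡ a ↑ˡ n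
      leftBlock i with L (i ↑ˡ n) in eq
      ... | p with split m n p
      ...   | inˡ a = a , refl
      ...   | inʳ b = ⊥-elim (ℕ.<⇒≱ (Fin.toℕ<n i) (subst (m ℕ.≤_) (Fin.toℕ-↑ˡ i n) m≤i))
        where
        m≤i : m ℕ.≤ toℕ (i ↑ˡ n)
        m≤i = below⇒≤position (P ⊕ Q) L-lin (_↑ˡ n) (Fin.↑ˡ-injective n _ _) (i ↑ˡ n)
                (λ x → subst (x ↑ˡ n <⊕_) (sym eq) (↑ˡ<⊕↑ʳ x b))

      A : Seq P
      A i = proj₁ (leftBlock i)

      L-↑ˡ : ∀ i → L (i ↑ˡ n) ≡ A i ↑ˡ n
      L-↑ˡ i = proj₂ (leftBlock i)

      A-inj : Injective _≡_ _≡_ A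
      A-inj {i} {j} Ai≡Aj = Fin.↑ˡ-injective n i j
        (L-inj (trans (L-↑ˡ i) (trans (cong (_↑ˡ n) Ai≡Aj) (sym (L-↑ˡ j)))))

      rightBlock : ∀ j → ∃ λ b → L (m ↑ʳ j) ≡ m ↑ʳ b
      rightBlock j with L (m ↑ʳ j) in eq
      ... | p with split m n p
      ...   | inʳ b = b , refl
      ...   | inˡ a with injective⇒strictlySurjective A-inj a
      ...     | i , Ai≡a = ⊥-elim (↑ˡ≢↑ʳ i j (L-inj (trans (L-↑ˡ i) (trans (cong (_↑ˡ n) Ai≡a) (sym eq)))))

      B : Seq Q
      B j = proj₁ (rightBlock j)

      L-↑ʳ : ∀ j → L (m ↑ʳ j) ≡ m ↑ʳ B j
      L-↑ʳ j = proj₂ (rightBlock j)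

      B-inj : Injective _≡_ _≡_ B
      B-inj {i} {j} Bi≡Bj = Fin.↑ʳ-injective m i j
        (L-inj (trans (L-↑ʳ i) (trans (cong (m ↑ʳ_) Bi≡Bj) (sym (L-↑ʳ j)))))

      A-lin : IsLinExt P A
      A-lin = injective⇒bijective A-inj , λ i j Ai<Aj →
        ↑ˡ-<⁻ (L-order _ _ (subst₂ _<⊕_ (sym (L-↑ˡ i)) (sym (L-↑ˡ j)) (<⊕-↑ˡ⁺ Ai<Aj)))

      B-lin : IsLinExt Q B
      B-lin = injective⇒bijective B-inj , λ i j Bi<Bj →
        ↑ʳ-<⁻ m (L-order _ _ (subst₂ _<⊕_ (sym (L-↑ʳ i)) (sym (L-↑ʳ j)) (<⊕-↑ʳ⁺ Bi<Bj)))

      L≗A++B : L ≗ A ++ˢ B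
      L≗A++B p with split m n p
      ... | inˡ i = trans (L-↑ˡ i) (sym (++ˢ-↑ˡ A B i))
      ... | inʳ j = trans (L-↑ʳ j) (sym (++ˢ-↑ʳ A B j))

    linExt-split : ∃₂ λ A B → IsLinExt P A × IsLinExt Q B × L ≗ A ++ˢ B
    linExt-split = A , B , A-lin , B-lin , L≗A++B

  ⊕-isOrdinalSumComparison : IsOrdinalSumComparison (comparable P) (comparable Q) (comparable (P ⊕ Q))
  ⊕-isOrdinalSumComparison = record
    { ↑ˡ↑ˡ = λ a b → cong₂ comparable⊎ (Fin.splitAt-↑ˡ m a n) (Fin.splitAt-↑ˡ m b n)
    ; ↑ʳ↑ʳ = λ a b → cong₂ comparable⊎ (Fin.splitAt-↑ʳ m n a) (Fin.splitAt-↑ʳ m n b)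
    ; ↑ˡ↑ʳ = λ a b → cong₂ comparable⊎ (Fin.splitAt-↑ˡ m a n) (Fin.splitAt-↑ʳ m n b)
    }
    where
    comparable⊎ : Fin m ⊎ Fin n → Fin m ⊎ Fin n → Bool
    comparable⊎ u v = does (sum-dec P Q u v ⊎-dec sum-dec P Q v u)

  restrictˡ : Word (P ⊕ Q) → Word P
  restrictˡ = mapMaybe projˡ

  restrictʳ : Word (P ⊕ Q) → Word Q
  restrictʳ = mapMaybe projʳ

  act-++ˢ : ∀ w A B → act (P ⊕ Q) w (A ++ˢ B) ≗ act P (restrictˡ w) A ++ˢ act Q (restrictʳ w) B
  act-++ˢ []      A B p = refl
  act-++ˢ (g ∷ w) A B p = begin
    move (P ⊕ Q) g (act (P ⊕ Q) w (A ++ˢ B)) p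
      ≡⟨ moveN-cong (m + n) (comparable (P ⊕ Q)) g (act-++ˢ w A B) p ⟩
    move (P ⊕ Q) g (act P (restrictˡ w) A ++ˢ act Q (restrictʳ w) B) p
      ≡⟨ moveN-++ˢ ⊕-isOrdinalSumComparison g _ _ p ⟩
    (maybeMove (comparable P) (projˡ g) (act P (restrictˡ w) A) ++ˢ
     maybeMove (comparable Q) (projʳ g) (act Q (restrictʳ w) B)) p
      ≡⟨ cong₂ (λ A′ B′ → (A′ ++ˢ B′) p) (act-mapMaybe-∷ P projˡ g w A) (act-mapMaybe-∷ Q projʳ g w B) ⟨
    (act P (restrictˡ (g ∷ w)) A ++ˢ act Q (restrictʳ (g ∷ w)) B) p
      ∎
    where open ≡-Reasoning

  act-++ˢ-↑ˡ : ∀ w A B a → act (P ⊕ Q) w (A ++ˢ B) (a ↑ˡ n) ≡ act P (restrictˡ w) A a ↑ˡ n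
  act-++ˢ-↑ˡ w A B a = trans (act-++ˢ w A B (a ↑ˡ n)) (++ˢ-↑ˡ _ _ a)

  act-++ˢ-↑ʳ : ∀ w A B b → act (P ⊕ Q) w (A ++ˢ B) (m ↑ʳ b) ≡ m ↑ʳ act Q (restrictʳ w) B b
  act-++ˢ-↑ʳ w A B b = trans (act-++ˢ w A B (m ↑ʳ b)) (++ˢ-↑ʳ _ _ b)

  restrict : Word (P ⊕ Q) → Word P × Word Q
  restrict w = restrictˡ w , restrictʳ w

  restrict-cong : ∀ {w v} → w ≈⊕ v → restrictˡ w ≈₁ restrictˡ v × restrictʳ w ≈₂ restrictʳ v
  restrict-cong {w} {v} w≈v = onLeft , onRight
    where
    open ≡-Reasoning

    onLeft : restrictˡ w ≈₁ restrictˡ v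
    onLeft A A-lin a = Fin.↑ˡ-injective n _ _ (begin
      act P (restrictˡ w) A a ↑ˡ n      ≡⟨ act-++ˢ-↑ˡ w A B a ⟨
      act (P ⊕ Q) w (A ++ˢ B) (a ↑ˡ n)  ≡⟨ w≈v (A ++ˢ B) (++ˢ-isLinExt A-lin B-lin) (a ↑ˡ n) ⟩
      act (P ⊕ Q) v (A ++ˢ B) (a ↑ˡ n)  ≡⟨ act-++ˢ-↑ˡ v A B a ⟩
      act P (restrictˡ v) A a ↑ˡ n      ∎)
      where
      B : Seq Q
      B = proj₁ (linearExtension Q)
      B-lin : IsLinExt Q B
      B-lin = proj₂ (linearExtension Q)

    onRight : restrictʳ w ≈₂ restrictʳ v
    onRight B B-lin b = Fin.↑ʳ-injective m _ _ (begin
      m ↑ʳ act Q (restrictʳ w) B b      ≡⟨ act-++ˢ-↑ʳ w A B b ⟨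
      act (P ⊕ Q) w (A ++ˢ B) (m ↑ʳ b)  ≡⟨ w≈v (A ++ˢ B) (++ˢ-isLinExt A-lin B-lin) (m ↑ʳ b) ⟩
      act (P ⊕ Q) v (A ++ˢ B) (m ↑ʳ b)  ≡⟨ act-++ˢ-↑ʳ v A B b ⟩
      m ↑ʳ act Q (restrictʳ v) B b      ∎)
      where
      A : Seq P
      A = proj₁ (linearExtension P)
      A-lin : IsLinExt P A
      A-lin = proj₂ (linearExtension P)

  restrict-injective : ∀ {w v} → restrictˡ w ≈₁ restrictˡ v × restrictʳ w ≈₂ restrictʳ v → w ≈⊕ v
  restrict-injective {w} {v} (wˡ≈vˡ , wʳ≈vʳ) L L-lin p
    with A , B , A-lin , B-lin , L≗A++B ← linExt-split L-lin = begin
    act (P ⊕ Q) w L p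
      ≡⟨ act-cong (P ⊕ Q) w L≗A++B p ⟩
    act (P ⊕ Q) w (A ++ˢ B) p
      ≡⟨ act-++ˢ w A B p ⟩
    (act P (restrictˡ w) A ++ˢ act Q (restrictʳ w) B) p
      ≡⟨ ++ˢ-cong (wˡ≈vˡ A A-lin) (wʳ≈vʳ B B-lin) p ⟩
    (act P (restrictˡ v) A ++ˢ act Q (restrictʳ v) B) p
      ≡⟨ act-++ˢ v A B p ⟨
    act (P ⊕ Q) v (A ++ˢ B) p
      ≡⟨ act-cong (P ⊕ Q) v L≗A++B p ⟨
    act (P ⊕ Q) v L p ∎
    where open ≡-Reasoning

  embed : Word P × Word Q → Word (P ⊕ Q)
  embed (wˡ , wʳ) = map (_↑ᵍˡ n) wˡ ++ map (m ↑ᵍʳ_) wʳ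

  restrictˡ-embed : ∀ wˡ wʳ → restrictˡ (embed (wˡ , wʳ)) ≡ wˡ
  restrictˡ-embed wˡ wʳ = begin
    restrictˡ (map (_↑ᵍˡ n) wˡ ++ map (m ↑ᵍʳ_) wʳ)
      ≡⟨ List.mapMaybe-++ projˡ (map (_↑ᵍˡ n) wˡ) _ ⟩
    restrictˡ (map (_↑ᵍˡ n) wˡ) ++ restrictˡ (map (m ↑ᵍʳ_) wʳ)
      ≡⟨ cong₂ _++_ (List.mapMaybe-map-retract projˡ-↑ᵍˡ wˡ) (List.mapMaybe-map-none (projˡ-↑ᵍʳ m) wʳ) ⟩
    wˡ ++ []
      ≡⟨ List.++-identityʳ wˡ ⟩
    wˡ ∎
    where open ≡-Reasoning

  restrictʳ-embed : ∀ wˡ wʳ → restrictʳ (embed (wˡ , wʳ)) ≡ wʳ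
  restrictʳ-embed wˡ wʳ = begin
    restrictʳ (map (_↑ᵍˡ n) wˡ ++ map (m ↑ᵍʳ_) wʳ)
      ≡⟨ List.mapMaybe-++ projʳ (map (_↑ᵍˡ n) wˡ) _ ⟩
    restrictʳ (map (_↑ᵍˡ n) wˡ) ++ restrictʳ (map (m ↑ᵍʳ_) wʳ)
      ≡⟨ cong₂ _++_ (List.mapMaybe-map-none projʳ-↑ᵍˡ wˡ) (List.mapMaybe-map-retract (projʳ-↑ᵍʳ m) wʳ) ⟩
    wʳ ∎
    where open ≡-Reasoning

  restrict-surjective : ∀ y → ∃ λ x → ∀ {z} → z ≈⊕ x → restrictˡ z ≈₁ proj₁ y × restrictʳ z ≈₂ proj₂ y
  restrict-surjective (wˡ , wʳ) = x , λ {z} z≈x →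
    ≈-trans P {restrictˡ z} {restrictˡ x} {wˡ}
      (proj₁ (restrict-cong {z} {x} z≈x)) (≈-reflexive P (restrictˡ-embed wˡ wʳ)) ,
    ≈-trans Q {restrictʳ z} {restrictʳ x} {wʳ}
      (proj₂ (restrict-cong {z} {x} z≈x)) (≈-reflexive Q (restrictʳ-embed wˡ wʳ))
    where
    x : Word (P ⊕ Q)
    x = embed (wˡ , wʳ)

proposition4p3 : (P Q : FinPoset) →
    ∃ λ φ → GroupMorphisms.IsGroupIsomorphism (BK (P ⊕ Q)) (BK× P Q) φ
proposition4p3 P Q = restrict , record
  { isGroupMonomorphism = record
    { isGroupHomomorphism = record
      { isMonoidHomomorphism = record
        { isMagmaHomomorphism = record
          { isRelHomomorphism = record { cong = λ {w} {v} → restrict-cong {w} {v} }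
          ; homo = λ w v → ≈-reflexive P (List.mapMaybe-++ projˡ w v) ,
                           ≈-reflexive Q (List.mapMaybe-++ projʳ w v)
          }
        ; ε-homo = ≈-reflexive P {[]} refl , ≈-reflexive Q {[]} refl
        }
      ; ⁻¹-homo = λ w → ≈-reflexive P (mapMaybe-reverse projˡ w) ,
                        ≈-reflexive Q (mapMaybe-reverse projʳ w)
      }
    ; injective = λ {w} {v} → restrict-injective {w} {v}
    }
  ; surjective = restrict-surjective
  }
  where open OrdinalSum P Q
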